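{- Let $s$ and $t$ be positive integers and let $G=(V,E)$ be a connected graph containing no induced $P_t$, no induced $SDK_s$ and no $K_4$ (as an induced subgraph). Let $S_1,\dots,S_{t-1}$ be produced by the construction described in the context (for any choices made in it). Then for every $i=1,2,\dots,t-2$, $|S_{i+1}|\le |S_i|\,(1+R(4,R(4,s)))$.
   Context: $P_t$ is the path on $t$ vertices; $K_{1,s}$ is the complete bipartite graph with parts of sizes $1$ and $s$; $SDK_s$ is the one-subdivision of $K_{1,s}$, obtained by replacing each edge $uv$ by a path $u w v$ through a new vertex $w$. $R(k,l)$ denotes the Ramsey number: the least integer such that every graph on at least $R(k,l)$ vertices contains a clique of size $k$ or a stable set of size $l$. For $v\in V$, $N(v)$ is the set of neighbors of $v$, and for $X\subseteq V$, $N(X)=\bigcup_{v\in X}N(v)$. Construction: pick an arbitrary vertex $a\in V$ and set $S_1=\{a\}$. For $i=1,2,\dots,t-2$: let $B_i=N(S_i)$ and $W_i=V\setminus(B_i\cup S_i)$; write $S_i=\{v_1,\dots,v_{|S_i|}\}$ (any order) and for $j=1,\dots,|S_i|$ let $B_i^j=\{v\in B_i\setminus\bigcup_{k=1}^{j-1}B_i^k : v \text{ is adjacent to } v_j\}$; for each $j$ let $X_i^j\subseteq B_i^j$ be an inclusion-minimal set such that every $w\in W_i$ with $N(w)\cap B_i^j\neq\emptyset$ satisfies $N(w)\cap X_i^j\neq\emptyset$; let $X_i=\bigcup_j X_i^j$ and $S_{i+1}=S_i\cup X_i$. -}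

module Defs where

open import Data.Nat using (ℕ; zero; suc; _+_; _*_; _∸_; _≤_; _<_; _≡ᵇ_; _≤ᵇ_)
open import Data.Bool using (Bool; true; false; _∧_; _∨_; not)
open import Data.Fin using (Fin; toℕ)
open import Data.Fin.Subset using (Subset; _∈_; _⊆_; _∩_; _∪_; _─_; ∁; ⋃; ∣_∣; ⁅_⁆)
open import Data.Vec using (Vec; tabulate; toList)
open import Data.List using (List; []; _∷_)
open import Data.Bool.ListAction using (or)
open import Data.List.Membership.Propositional using () renaming (_∈_ to _∈ₗ_)
open import Data.List.Relation.Unary.Unique.Propositional using (Unique)
open import Data.List.Relation.Binary.Pointwise using (Pointwise)
open import Data.Product using (Σ; ∃; _×_; _,_)
open import Data.Sum using (_⊎_)
open import Relation.Binary.PropositionalEquality using (_≡_; _≢_)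
open import Relation.Nullary using (¬_)

record Graph (n : ℕ) : Set where
  field
    adj    : Fin n → Fin n → Bool
    sym    : ∀ u v → adj u v ≡ adj v u
    irrefl : ∀ v → adj v v ≡ false
open Graph public

Adj : ∀ {n} → Graph n → Fin n → Fin n → Set
Adj G u v = adj G u v ≡ true

data Walk {n} (G : Graph n) : Fin n → Fin n → Set where
  here : ∀ {u} → Walk G u u
  step : ∀ {u v w} → Adj G u v → Walk G v w → Walk G u w

Connected : ∀ {n} → Graph n → Set
Connected G = ∀ u v → Walk G u v

HasClique : ∀ {n} → Graph n → ℕ → Set
HasClique {n} G k = Σ (Fin k → Fin n) λ f →
  (∀ i j → f i ≡ f j → i ≡ j) × (∀ i j → i ≢ j → Adj G (f i) (f j))

HasStable : ∀ {n} → Graph n → ℕ → Set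
HasStable {n} G k = Σ (Fin k → Fin n) λ f →
  (∀ i j → f i ≡ f j → i ≡ j) × (∀ i j → ¬ Adj G (f i) (f j))

RamseyProperty : ℕ → ℕ → ℕ → Set
RamseyProperty k l r = ∀ m → r ≤ m → (H : Graph m) → HasClique H k ⊎ HasStable H l

IsRamseyNumber : ℕ → ℕ → ℕ → Set
IsRamseyNumber k l r = RamseyProperty k l r × (∀ r' → RamseyProperty k l r' → r ≤ r')

InducedCopy : ∀ {h n} → (Fin h → Fin h → Bool) → Graph n → Set
InducedCopy {h} {n} H G = Σ (Fin h → Fin n) λ f →
  (∀ i j → f i ≡ f j → i ≡ j) × (∀ i j → adj G (f i) (f j) ≡ H i j)

PathAdj : (t : ℕ) → Fin t → Fin t → Bool
PathAdj t i j = (suc (toℕ i) ≡ᵇ toℕ j) ∨ (suc (toℕ j) ≡ᵇ toℕ i)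

-- SDK_s on vertices 0..2s : centre 0, subdivision vertices 1..s,
-- leaves s+1..2s, with edges 0 - k and k - (k+s) for k = 1..s
SDKAdj₀ : ℕ → ℕ → ℕ → Bool
SDKAdj₀ s a b =
  ((a ≡ᵇ 0) ∧ (1 ≤ᵇ b) ∧ (b ≤ᵇ s)) ∨ ((1 ≤ᵇ a) ∧ (a ≤ᵇ s) ∧ (b ≡ᵇ a + s))

SDKAdj : (s : ℕ) → Fin (suc (s + s)) → Fin (suc (s + s)) → Bool
SDKAdj s i j = SDKAdj₀ s (toℕ i) (toℕ j) ∨ SDKAdj₀ s (toℕ j) (toℕ i)

Nv : ∀ {n} → Graph n → Fin n → Subset n
Nv G v = tabulate (adj G v)

NS : ∀ {n} → Graph n → Subset n → Subset n
NS {n} G S = tabulate λ w → or (toList (tabulate λ (u : Fin n) → isIn u ∧ adj G u w))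
  where
  isIn : Fin n → Bool
  isIn u = Data.Vec.lookup S u

-- Given the remaining part R of B_i and the ordering v_1,...,v_k of S_i,
-- produce B_i^1,...,B_i^k :  B^j = { v ∈ B \ (B^1 ∪ ... ∪ B^(j-1)) : v ~ v_j }
blocks : ∀ {n} → Graph n → Subset n → List (Fin n) → List (Subset n)
blocks G R []       = []
blocks G R (v ∷ vs) = (R ∩ Nv G v) ∷ blocks G (R ─ Nv G v) vs

Covers : ∀ {n} → Graph n → Subset n → Subset n → Subset n → Set
Covers G W B X = ∀ w → w ∈ W → (∃ λ u → u ∈ B × Adj G w u) → ∃ λ u → u ∈ X × Adj G w u

MinCover : ∀ {n} → Graph n → Subset n → Subset n → Subset n → Set
MinCover G W B X = X ⊆ B × Covers G W B X × (∀ Y → Y ⊆ X → Covers G W B Y → X ⊆ Y)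

Step : ∀ {n} → Graph n → Subset n → Subset n → Set
Step {n} G S S' =
  Σ (List (Fin n)) λ ord →
    Unique ord × (∀ v → (v ∈ₗ ord → v ∈ S) × (v ∈ S → v ∈ₗ ord)) ×
    Σ (List (Subset n)) λ Xs →
      Pointwise (MinCover G W) (blocks G B ord) Xs × (S' ≡ S ∪ ⋃ Xs)
  where
  B W : Subset n
  B = NS G S
  W = ∁ (B ∪ S)

module Submission where

-- S_{i+1} = S_i ∪ ⋃_j X_i^j and the blocks B_i^j are indexed by the vertices
-- v_j of S_i, so it suffices to show |X| < R(4, R(4, s)) for one minimal
-- cover X of a block B ⊆ N(v) (v ∈ S_i).  Minimality gives every x ∈ X a
-- private neighbour p(x) ∈ W_i, i.e. one adjacent to x and to no other
-- vertex of X; W_i avoids v and N(v).  If |X| ≥ R(4, R(4, s)), Ramsey's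
-- theorem (the graph has no K_4) yields a stable set of R(4, s) vertices
-- of X, and then a set of s of them whose private neighbours are also
-- stable.  Together with v these vertices form an induced SDK_s (a
-- "spider"), which is excluded.

open import Defs
open import Data.Nat using (ℕ; zero; suc; _+_; _*_; _∸_; _≤_; _<_; z≤n; s≤s; _<ᵇ_; _≡ᵇ_)
open import Data.Nat.Properties
  using (≤-trans; ≤-refl; module ≤-Reasoning; <⇒≤; ≰⇒>; <⇒≱; +-suc; +-comm;
         +-monoʳ-≤; +-mono-≤; *-monoˡ-≤; *-suc; m≤n+m; +-cancelʳ-≡)
open import Data.Bool using (Bool; true; false; _∧_)
open import Data.Bool.Properties using (¬-not; ∨-comm) renaming (_≟_ to _≟ᵇ_)
open import Data.Bool.ListAction using (or)
open import Data.Fin using (Fin; zero; suc; toℕ; _↑ˡ_; _↑ʳ_; splitAt)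
open import Data.Fin.Properties
  using (any?; suc-injective; toℕ-↑ˡ; toℕ-↑ʳ; splitAt-↑ˡ; splitAt-↑ʳ; splitAt⁻¹-↑ˡ; splitAt⁻¹-↑ʳ;
         toℕ<n; toℕ-injective)
  renaming (_≟_ to _≟ᶠ_)
open import Data.Fin.Subset using (Subset; _∈_; _∉_; _∪_; _∩_; _-_; _⊆_; ∁; ⋃; ∣_∣; ⁅_⁆; inside; outside)
open import Data.Fin.Subset.Properties
  using (_∈?_; x∈p∧x≢y⇒x∈p-y; x∈p⇒∣p-x∣<∣p∣; ∣p∣≤∣x∷p∣; ∣⊥∣≡0; p⊆q⇒∣p∣≤∣q∣; p─q⊆p;
         p∩q⊆q; x∈∁p⇒x∉p; x∈p∪q⁺)
open import Data.Vec using ([]; _∷_; here; there; tabulate; toList; lookup)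
open import Data.Vec.Properties using (lookup∘tabulate; []=⇒lookup; lookup⇒[]=)
open import Data.List using (List; []; _∷_; length)
open import Data.List.Membership.Propositional using () renaming (_∈_ to _∈ₗ_)
open import Data.List.Relation.Unary.Any using () renaming (here to hereₗ; there to thereₗ)
open import Data.List.Relation.Unary.AllPairs using (_∷_)
open import Data.List.Relation.Unary.Unique.Propositional using (Unique)
open import Data.List.Relation.Unary.Unique.Propositional.Properties using (Unique[x∷xs]⇒x∉xs)
open import Data.List.Relation.Binary.Pointwise using (Pointwise; []; _∷_)
open import Data.Product using (Σ; ∃; _×_; _,_; proj₁; proj₂)
open import Data.Sum using (inj₁; inj₂; [_,_]′)
open import Data.Empty using (⊥-elim)
open import Relation.Binary.PropositionalEquality
  using (_≡_; _≢_; refl; trans; cong; subst) renaming (sym to ≡-sym)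
open import Relation.Nullary using (¬_; Dec; yes; no)
open import Relation.Nullary.Decidable using (_×-dec_; ¬?)

IsInjective : ∀ {m n} → (Fin m → Fin n) → Set
IsInjective f = ∀ i j → f i ≡ f j → i ≡ j

unique-length≤∣p∣ : ∀ {n} (p : Subset n) (l : List (Fin n)) →
  Unique l → (∀ v → v ∈ₗ l → v ∈ p) → length l ≤ ∣ p ∣
unique-length≤∣p∣ p []       _ _ = z≤n
unique-length≤∣p∣ p (x ∷ xs) u@(_ ∷ xs-unique) l⊆p =
  ≤-trans (s≤s (unique-length≤∣p∣ (p - x) xs xs-unique xs⊆p-x)) (x∈p⇒∣p-x∣<∣p∣ (l⊆p x (hereₗ refl)))
  where
  xs⊆p-x : ∀ v → v ∈ₗ xs → v ∈ p - x
  xs⊆p-x v v∈xs = x∈p∧x≢y⇒x∈p-y (l⊆p v (thereₗ v∈xs))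
                    (λ v≡x → Unique[x∷xs]⇒x∉xs u (subst (_∈ₗ xs) v≡x v∈xs))

∣p∪q∣≤∣p∣+∣q∣ : ∀ {n} (p q : Subset n) → ∣ p ∪ q ∣ ≤ ∣ p ∣ + ∣ q ∣
∣p∪q∣≤∣p∣+∣q∣ []            []            = z≤n
∣p∪q∣≤∣p∣+∣q∣ (inside  ∷ p) (b ∷ q)       =
  s≤s (≤-trans (∣p∪q∣≤∣p∣+∣q∣ p q) (+-monoʳ-≤ ∣ p ∣ (∣p∣≤∣x∷p∣ b q)))
∣p∪q∣≤∣p∣+∣q∣ (outside ∷ p) (inside  ∷ q) =
  subst (suc ∣ p ∪ q ∣ ≤_) (≡-sym (+-suc ∣ p ∣ ∣ q ∣)) (s≤s (∣p∪q∣≤∣p∣+∣q∣ p q))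
∣p∪q∣≤∣p∣+∣q∣ (outside ∷ p) (outside ∷ q) = ∣p∪q∣≤∣p∣+∣q∣ p q

enumerate : ∀ {n} (p : Subset n) → Fin ∣ p ∣ → Fin n
enumerate (inside  ∷ p) zero    = zero
enumerate (inside  ∷ p) (suc i) = suc (enumerate p i)
enumerate (outside ∷ p) i       = suc (enumerate p i)

enumerate-∈ : ∀ {n} (p : Subset n) i → enumerate p i ∈ p
enumerate-∈ (inside  ∷ p) zero    = here
enumerate-∈ (inside  ∷ p) (suc i) = there (enumerate-∈ p i)
enumerate-∈ (outside ∷ p) i       = there (enumerate-∈ p i)

enumerate-injective : ∀ {n} (p : Subset n) → IsInjective (enumerate p)
enumerate-injective (inside  ∷ p) zero    zero    _  = refl
enumerate-injective (inside  ∷ p) zero    (suc j) ()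
enumerate-injective (inside  ∷ p) (suc i) zero    ()
enumerate-injective (inside  ∷ p) (suc i) (suc j) e  = cong suc (enumerate-injective p i j (suc-injective e))
enumerate-injective (outside ∷ p) i       j       e  = enumerate-injective p i j (suc-injective e)

or-tabulate-true : ∀ {m} (g : Fin m → Bool) u → g u ≡ true → or (toList (tabulate g)) ≡ true
or-tabulate-true g zero    gu rewrite gu = refl
or-tabulate-true g (suc u) gu with g zero
... | true  = refl
... | false = or-tabulate-true (λ i → g (suc i)) u gu

∈Nv⇒adj : ∀ {n} (G : Graph n) v x → x ∈ Nv G v → Adj G v x
∈Nv⇒adj G v x x∈Nv = trans (≡-sym (lookup∘tabulate (adj G v) x)) ([]=⇒lookup x∈Nv)

adj⇒∈NS : ∀ {n} (G : Graph n) (S : Subset n) v w → v ∈ S → Adj G v w → w ∈ NS G S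
adj⇒∈NS G S v w v∈S v~w = lookup⇒[]= w _
  (trans (lookup∘tabulate _ w) (or-tabulate-true (λ u → lookup S u ∧ adj G u w) v v∧w))
  where
  v∧w : (lookup S v ∧ adj G v w) ≡ true
  v∧w rewrite []=⇒lookup v∈S = v~w

Remote : ∀ {n} → Graph n → Fin n → Subset n → Set
Remote G v W = ∀ w → w ∈ W → adj G v w ≡ false × v ≢ w

remote-from-S : ∀ {n} (G : Graph n) (S : Subset n) v → v ∈ S → Remote G v (∁ (NS G S ∪ S))
remote-from-S G S v v∈S w w∈W =
  ¬-not (λ v~w → w∉ (x∈p∪q⁺ (inj₁ (adj⇒∈NS G S v w v∈S v~w)))) ,
  (λ v≡w → w∉ (x∈p∪q⁺ (inj₂ (subst (_∈ S) v≡w v∈S))))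
  where
  w∉ : w ∉ NS G S ∪ S
  w∉ = x∈∁p⇒x∉p w∈W

induced : ∀ {m n} (G : Graph n) → (Fin m → Fin n) → Graph m
induced G e = record
  { adj    = λ i j → adj G (e i) (e j)
  ; sym    = λ i j → Graph.sym G (e i) (e j)
  ; irrefl = λ i → Graph.irrefl G (e i)
  }

StableSubfamily : ∀ {n m} (G : Graph n) (l : ℕ) → (Fin m → Fin n) → Set
StableSubfamily {m = m} G l e =
  Σ (Fin l → Fin m) λ g → IsInjective g × (∀ i j → adj G (e (g i)) (e (g j)) ≡ false)

stable-subfamily : ∀ {n k l r} (G : Graph n) → ¬ HasClique G k → RamseyProperty k l r →
  ∀ {m} (e : Fin m → Fin n) → IsInjective e → r ≤ m → StableSubfamily G l e
stable-subfamily G no-clique ramsey {m} e e-inj r≤m with ramsey m r≤m (induced G e)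
... | inj₁ (f , f-inj , clique) =
  ⊥-elim (no-clique ((λ i → e (f i)) , (λ i j eq → f-inj i j (e-inj (f i) (f j) eq)) , clique))
... | inj₂ (g , g-inj , stable) = g , g-inj , λ i j → ¬-not (stable i j)

HasNeighbourIn : ∀ {n} → Graph n → Subset n → Fin n → Set
HasNeighbourIn G Y w = ∃ λ u → u ∈ Y × Adj G w u

hasNeighbourIn? : ∀ {n} (G : Graph n) (Y : Subset n) w → Dec (HasNeighbourIn G Y w)
hasNeighbourIn? G Y w = any? (λ u → (u ∈? Y) ×-dec (adj G w u ≟ᵇ true))

IsPrivateNeighbour : ∀ {n} → Graph n → (W X : Subset n) (x w : Fin n) → Set
IsPrivateNeighbour G W X x w = w ∈ W × Adj G w x × (∀ y → y ∈ X → Adj G w y → y ≡ x)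

-- In a minimal cover X, every x ∈ X has a private neighbour in W: otherwise
-- X - x would still cover, contradicting minimality.
private-neighbour : ∀ {n} (G : Graph n) W B X → MinCover G W B X → ∀ x → x ∈ X →
  ∃ (IsPrivateNeighbour G W X x)
private-neighbour G W B X (_ , covers , minimal) x x∈X
  with any? (λ w → (w ∈? W) ×-dec (hasNeighbourIn? G B w ×-dec ¬? (hasNeighbourIn? G (X - x) w)))
... | no no-private = ⊥-elim (<⇒≱ (x∈p⇒∣p-x∣<∣p∣ x∈X) (p⊆q⇒∣p∣≤∣q∣ X⊆X-x))
  where
  X-x-covers : Covers G W B (X - x)
  X-x-covers w w∈W w~B with hasNeighbourIn? G (X - x) w
  ... | yes w~X-x = w~X-x
  ... | no  w≁X-x = ⊥-elim (no-private (w , w∈W , w~B , w≁X-x))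
  X⊆X-x : X ⊆ X - x
  X⊆X-x = minimal (X - x) (p─q⊆p X ⁅ x ⁆) X-x-covers
... | yes (w , w∈W , w~B , w≁X-x) with covers w w∈W w~B
...   | u , u∈X , w~u = w , w∈W , subst (Adj G w) (only-x u u∈X w~u) w~u , only-x
  where
  only-x : ∀ y → y ∈ X → Adj G w y → y ≡ x
  only-x y y∈X w~y with y ≟ᶠ x
  ... | yes y≡x = y≡x
  ... | no  y≢x = ⊥-elim (w≁X-x (y , x∈p∧x≢y⇒x∈p-y y∈X y≢x , w~y))

middleᵢ : ∀ {s} → Fin s → Fin (suc (s + s))
middleᵢ {s} k = suc (k ↑ˡ s)

leafᵢ : ∀ {s} → Fin s → Fin (suc (s + s))
leafᵢ {s} k = suc (s ↑ʳ k)

data SDKVertex (s : ℕ) : Fin (suc (s + s)) → Set where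
  atCentre : SDKVertex s zero
  atMiddle : ∀ (k : Fin s) → SDKVertex s (middleᵢ k)
  atLeaf   : ∀ (k : Fin s) → SDKVertex s (leafᵢ k)

sdk-vertex : ∀ s i → SDKVertex s i
sdk-vertex s zero    = atCentre
sdk-vertex s (suc i) with splitAt s i in eq
... | inj₁ k rewrite ≡-sym (splitAt⁻¹-↑ˡ eq) = atMiddle k
... | inj₂ k rewrite ≡-sym (splitAt⁻¹-↑ʳ eq) = atLeaf k

<ᵇ-true : ∀ {a b} → a < b → (a <ᵇ b) ≡ true
<ᵇ-true (s≤s z≤n)       = refl
<ᵇ-true (s≤s (s≤s a<b)) = <ᵇ-true (s≤s a<b)

+<ᵇ-false : ∀ s b → (s + b <ᵇ s) ≡ false
+<ᵇ-false zero    b = refl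
+<ᵇ-false (suc s) b = +<ᵇ-false s b

≡ᵇ-refl : ∀ a → (a ≡ᵇ a) ≡ true
≡ᵇ-refl zero    = refl
≡ᵇ-refl (suc a) = ≡ᵇ-refl a

≡ᵇ-false : ∀ a b → a ≢ b → (a ≡ᵇ b) ≡ false
≡ᵇ-false zero    zero    a≢b = ⊥-elim (a≢b refl)
≡ᵇ-false zero    (suc b) _   = refl
≡ᵇ-false (suc a) zero    _   = refl
≡ᵇ-false (suc a) (suc b) a≢b = ≡ᵇ-false a b (λ a≡b → a≢b (cong suc a≡b))

<⇒≢+ : ∀ {a b s} → b < s → b ≢ a + s
<⇒≢+ {a} {b} {s} b<s b≡a+s = <⇒≱ b<s (subst (s ≤_) (≡-sym b≡a+s) (m≤n+m s a))

sdk-sym : ∀ s i j → SDKAdj s i j ≡ SDKAdj s j i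
sdk-sym s i j = ∨-comm (SDKAdj₀ s (toℕ i) (toℕ j)) (SDKAdj₀ s (toℕ j) (toℕ i))

sdk-centre-middle : ∀ s (k : Fin s) → SDKAdj s zero (middleᵢ k) ≡ true
sdk-centre-middle s k rewrite toℕ-↑ˡ k s | <ᵇ-true (toℕ<n k) = refl

sdk-centre-leaf : ∀ s (k : Fin s) → SDKAdj s zero (leafᵢ k) ≡ false
sdk-centre-leaf s k rewrite toℕ-↑ʳ s k | +<ᵇ-false s (toℕ k) = refl

sdk-middle-middle : ∀ s (k k' : Fin s) → SDKAdj s (middleᵢ k) (middleᵢ k') ≡ false
sdk-middle-middle s k k'
  rewrite toℕ-↑ˡ k s | toℕ-↑ˡ k' s | <ᵇ-true (toℕ<n k) | <ᵇ-true (toℕ<n k')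
        | ≡ᵇ-false (toℕ k') (toℕ k + s) (<⇒≢+ (toℕ<n k'))
        | ≡ᵇ-false (toℕ k) (toℕ k' + s) (<⇒≢+ (toℕ<n k)) = refl

sdk-leaf-leaf : ∀ s (k k' : Fin s) → SDKAdj s (leafᵢ k) (leafᵢ k') ≡ false
sdk-leaf-leaf s k k'
  rewrite toℕ-↑ʳ s k | toℕ-↑ʳ s k' | +<ᵇ-false s (toℕ k) | +<ᵇ-false s (toℕ k') = refl

sdk-middle-leaf : ∀ s (k : Fin s) → SDKAdj s (middleᵢ k) (leafᵢ k) ≡ true
sdk-middle-leaf s k
  rewrite toℕ-↑ˡ k s | toℕ-↑ʳ s k | <ᵇ-true (toℕ<n k) | +-comm s (toℕ k) | ≡ᵇ-refl (toℕ k + s) = refl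

sdk-middle-leaf≢ : ∀ s (k k' : Fin s) → k ≢ k' → SDKAdj s (middleᵢ k) (leafᵢ k') ≡ false
sdk-middle-leaf≢ s k k' k≢k'
  rewrite toℕ-↑ˡ k s | toℕ-↑ʳ s k' | <ᵇ-true (toℕ<n k) | +<ᵇ-false s (toℕ k')
        | +-comm s (toℕ k')
        | ≡ᵇ-false (toℕ k' + s) (toℕ k + s)
            (λ eq → k≢k' (toℕ-injective (≡-sym (+-cancelʳ-≡ s (toℕ k') (toℕ k) eq)))) = refl

record Spider {n} (G : Graph n) (s : ℕ) : Set where
  field
    centre           : Fin n
    middle leaf      : Fin s → Fin n
    middle-injective : IsInjective middle
    leaf-injective   : IsInjective leaf
    centre≢leaf      : ∀ k → centre ≢ leaf k
    centre-middle    : ∀ k → adj G centre (middle k) ≡ true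
    centre-leaf      : ∀ k → adj G centre (leaf k) ≡ false
    middle-middle    : ∀ k k' → adj G (middle k) (middle k') ≡ false
    leaf-leaf        : ∀ k k' → adj G (leaf k) (leaf k') ≡ false
    middle-leaf      : ∀ k → adj G (middle k) (leaf k) ≡ true
    middle-leaf≢     : ∀ k k' → k ≢ k' → adj G (middle k) (leaf k') ≡ false

adjacent⇒≢ : ∀ {n} (G : Graph n) {a b} → adj G a b ≡ true → a ≢ b
adjacent⇒≢ G {a} a~b refl with trans (≡-sym a~b) (Graph.irrefl G a)
... | ()

separated⇒≢ : ∀ {n} (G : Graph n) {c a b} → adj G c a ≡ true → adj G c b ≡ false → a ≢ b
separated⇒≢ G {c} c~a c≁b refl with trans (≡-sym c~a) c≁b
... | ()

spider⇒SDK : ∀ {n s} {G : Graph n} → Spider G s → InducedCopy (SDKAdj s) G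
spider⇒SDK {n} {s} {G} spider = F , F-injective , F-adj
  where
  open Spider spider

  F : Fin (suc (s + s)) → Fin n
  F zero    = centre
  F (suc i) = [ middle , leaf ]′ (splitAt s i)

  image : ∀ {i} → SDKVertex s i → Fin n
  image atCentre     = centre
  image (atMiddle k) = middle k
  image (atLeaf k)   = leaf k

  F-image : ∀ {i} (u : SDKVertex s i) → F i ≡ image u
  F-image atCentre                              = refl
  F-image (atMiddle k) rewrite splitAt-↑ˡ s k s = refl
  F-image (atLeaf k)   rewrite splitAt-↑ʳ s s k = refl

  swap : ∀ {i j} (u : SDKVertex s i) (u' : SDKVertex s j) →
    adj G (image u) (image u') ≡ SDKAdj s i j → adj G (image u') (image u) ≡ SDKAdj s j i
  swap {i} {j} u u' e = trans (Graph.sym G (image u') (image u)) (trans e (sdk-sym s i j))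

  image-adj : ∀ {i j} (u : SDKVertex s i) (u' : SDKVertex s j) → adj G (image u) (image u') ≡ SDKAdj s i j
  image-adj atCentre     atCentre      = Graph.irrefl G centre
  image-adj atCentre     (atMiddle k)  = trans (centre-middle k) (≡-sym (sdk-centre-middle s k))
  image-adj atCentre     (atLeaf k)    = trans (centre-leaf k) (≡-sym (sdk-centre-leaf s k))
  image-adj (atMiddle k) (atMiddle k') = trans (middle-middle k k') (≡-sym (sdk-middle-middle s k k'))
  image-adj (atLeaf k)   (atLeaf k')   = trans (leaf-leaf k k') (≡-sym (sdk-leaf-leaf s k k'))
  image-adj (atMiddle k) (atLeaf k') with k ≟ᶠ k'
  ... | yes refl  = trans (middle-leaf k) (≡-sym (sdk-middle-leaf s k))
  ... | no  k≢k' = trans (middle-leaf≢ k k' k≢k') (≡-sym (sdk-middle-leaf≢ s k k' k≢k'))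
  image-adj (atMiddle k) atCentre      = swap atCentre (atMiddle k) (image-adj atCentre (atMiddle k))
  image-adj (atLeaf k)   atCentre      = swap atCentre (atLeaf k) (image-adj atCentre (atLeaf k))
  image-adj (atLeaf k)   (atMiddle k') = swap (atMiddle k') (atLeaf k) (image-adj (atMiddle k') (atLeaf k))

  image-injective : ∀ {i j} (u : SDKVertex s i) (u' : SDKVertex s j) → image u ≡ image u' → i ≡ j
  image-injective atCentre     atCentre      _ = refl
  image-injective atCentre     (atMiddle k)  e = ⊥-elim (adjacent⇒≢ G (centre-middle k) e)
  image-injective atCentre     (atLeaf k)    e = ⊥-elim (centre≢leaf k e)
  image-injective (atMiddle k) (atMiddle k') e = cong middleᵢ (middle-injective k k' e)
  image-injective (atLeaf k)   (atLeaf k')   e = cong leafᵢ (leaf-injective k k' e)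
  image-injective (atMiddle k) (atLeaf k')   e = ⊥-elim (separated⇒≢ G (centre-middle k) (centre-leaf k') e)
  image-injective (atMiddle k) atCentre      e = ≡-sym (image-injective atCentre (atMiddle k) (≡-sym e))
  image-injective (atLeaf k)   atCentre      e = ≡-sym (image-injective atCentre (atLeaf k) (≡-sym e))
  image-injective (atLeaf k)   (atMiddle k') e = ≡-sym (image-injective (atMiddle k') (atLeaf k) (≡-sym e))

  F-adj : ∀ i j → adj G (F i) (F j) ≡ SDKAdj s i j
  F-adj i j with sdk-vertex s i | sdk-vertex s j
  ... | u | u' rewrite F-image u | F-image u' = image-adj u u'

  F-injective : IsInjective F
  F-injective i j e = image-injective u u' (trans (≡-sym (F-image u)) (trans e (F-image u')))
    where
    u : SDKVertex s i
    u = sdk-vertex s i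
    u' : SDKVertex s j
    u' = sdk-vertex s j

module SmallCovers {n k s r₁ r₂ : ℕ} (G : Graph n)
  (no-sdk : ¬ InducedCopy (SDKAdj s) G) (no-clique : ¬ HasClique G k)
  (ramsey₁ : RamseyProperty k s r₁) (ramsey₂ : RamseyProperty k r₁ r₂) where

  -- A minimal cover X, w.r.t. a set W remote from v, of a set B ⊆ N(v)
  -- with at least R(k, R(k, s)) vertices yields a spider centred at v:
  -- R(k, s) of its vertices are pairwise non-adjacent, their private
  -- neighbours are distinct, and s of those are pairwise non-adjacent too.
  large-cover⇒spider : ∀ v W B X → Remote G v W → B ⊆ Nv G v →
    MinCover G W B X → r₂ ≤ ∣ X ∣ → Spider G s
  large-cover⇒spider v W B X remote B⊆Nv cover r₂≤∣X∣ = record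
    { centre           = v
    ; middle           = λ k → x (h k)
    ; leaf             = λ k → p (h k)
    ; middle-injective = λ k k' eq → h-injective k k' (x-injective (h k) (h k') eq)
    ; leaf-injective   = λ k k' eq → h-injective k k' (p-injective (h k) (h k') eq)
    ; centre≢leaf      = λ k → proj₂ (remote (p (h k)) (p∈W (h k)))
    ; centre-middle    = λ k → ∈Nv⇒adj G v (x (h k)) (B⊆Nv (proj₁ cover (x∈X (h k))))
    ; centre-leaf      = λ k → proj₁ (remote (p (h k)) (p∈W (h k)))
    ; middle-middle    = λ k k' → x-stable (h k) (h k')
    ; leaf-leaf        = proj₂ (proj₂ stable₂)
    ; middle-leaf      = λ k → trans (Graph.sym G (x (h k)) (p (h k))) (p~x (h k))
    ; middle-leaf≢     = λ k k' k≢k' → ¬-not λ x~p →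
        k≢k' (h-injective k k' (x-injective (h k) (h k')
          (p-private (h k') (x (h k)) (x∈X (h k)) (trans (Graph.sym G (p (h k')) (x (h k))) x~p))))
    }
    where
    stable₁ : StableSubfamily G r₁ (enumerate X)
    stable₁ = stable-subfamily G no-clique ramsey₂ (enumerate X) (enumerate-injective X) r₂≤∣X∣

    x : Fin r₁ → Fin n
    x i = enumerate X (proj₁ stable₁ i)

    x∈X : ∀ i → x i ∈ X
    x∈X i = enumerate-∈ X (proj₁ stable₁ i)

    x-injective : IsInjective x
    x-injective i j eq = proj₁ (proj₂ stable₁) i j (enumerate-injective X _ _ eq)

    x-stable : ∀ i j → adj G (x i) (x j) ≡ false
    x-stable = proj₂ (proj₂ stable₁)

    private-of : ∀ i → ∃ (IsPrivateNeighbour G W X (x i))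
    private-of i = private-neighbour G W B X cover (x i) (x∈X i)

    p : Fin r₁ → Fin n
    p i = proj₁ (private-of i)

    p∈W : ∀ i → p i ∈ W
    p∈W i = proj₁ (proj₂ (private-of i))

    p~x : ∀ i → Adj G (p i) (x i)
    p~x i = proj₁ (proj₂ (proj₂ (private-of i)))

    p-private : ∀ i y → y ∈ X → Adj G (p i) y → y ≡ x i
    p-private i = proj₂ (proj₂ (proj₂ (private-of i)))

    -- a private neighbour determines its vertex of X
    p-injective : IsInjective p
    p-injective i j eq = x-injective i j (p-private j (x i) (x∈X i) (subst (λ w → Adj G w (x i)) eq (p~x i)))

    stable₂ : StableSubfamily G s p
    stable₂ = stable-subfamily G no-clique ramsey₁ p p-injective ≤-refl

    h : Fin s → Fin r₁
    h = proj₁ stable₂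

    h-injective : IsInjective h
    h-injective = proj₁ (proj₂ stable₂)

  small-cover : ∀ v W B X → Remote G v W → B ⊆ Nv G v →
    MinCover G W B X → ∣ X ∣ < r₂
  small-cover v W B X remote B⊆Nv cover =
    ≰⇒> λ r₂≤∣X∣ → no-sdk (spider⇒SDK (large-cover⇒spider v W B X remote B⊆Nv cover r₂≤∣X∣))

  ⋃-covers-bound : ∀ (S R : Subset n) (ord : List (Fin n)) Xs → (∀ v → v ∈ₗ ord → v ∈ S) →
    Pointwise (MinCover G (∁ (NS G S ∪ S))) (blocks G R ord) Xs → ∣ ⋃ Xs ∣ ≤ length ord * r₂
  ⋃-covers-bound S R []        []       _     []                 = subst (_≤ 0) (≡-sym (∣⊥∣≡0 n)) z≤n
  ⋃-covers-bound S R (v ∷ ord) (X ∷ Xs) ord⊆S (cover ∷ covers) =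
    ≤-trans (∣p∪q∣≤∣p∣+∣q∣ X (⋃ Xs))
      (+-mono-≤ (<⇒≤ (small-cover v _ (R ∩ Nv G v) X (remote-from-S G S v v∈S) (p∩q⊆q R (Nv G v)) cover))
                (⋃-covers-bound S _ ord Xs (λ u m → ord⊆S u (thereₗ m)) covers))
    where
    v∈S : v ∈ S
    v∈S = ord⊆S v (hereₗ refl)

  step-bound : ∀ {S S'} → Step G S S' → ∣ S' ∣ ≤ ∣ S ∣ * (1 + r₂)
  step-bound {S} (ord , unique , ord↔S , Xs , covers , refl) = begin
    ∣ S ∪ ⋃ Xs ∣          ≤⟨ ∣p∪q∣≤∣p∣+∣q∣ S (⋃ Xs) ⟩
    ∣ S ∣ + ∣ ⋃ Xs ∣       ≤⟨ +-monoʳ-≤ ∣ S ∣ (⋃-covers-bound S _ ord Xs ord⊆S covers) ⟩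
    ∣ S ∣ + length ord * r₂ ≤⟨ +-monoʳ-≤ ∣ S ∣ (*-monoˡ-≤ r₂ (unique-length≤∣p∣ S ord unique ord⊆S)) ⟩
    ∣ S ∣ + ∣ S ∣ * r₂      ≡⟨ ≡-sym (*-suc ∣ S ∣ r₂) ⟩
    ∣ S ∣ * (1 + r₂)        ∎
    where
    open ≤-Reasoning
    ord⊆S : ∀ v → v ∈ₗ ord → v ∈ S
    ord⊆S v = proj₁ (ord↔S v)

-- Lemma 3.1.  Only the exclusion of K_4 and of an induced SDK_s and the
-- Ramsey properties of r₁ = R(4, s) and r₂ = R(4, r₁) are needed: the bound
-- holds for every single step of the construction.

lemma3p1 : (s t : ℕ) → 1 ≤ s → 1 ≤ t →
    {n : ℕ} (G : Graph n) → Connected G →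
    ¬ InducedCopy (PathAdj t) G → ¬ InducedCopy (SDKAdj s) G → ¬ HasClique G 4 →
    (r₁ r₂ : ℕ) → IsRamseyNumber 4 s r₁ → IsRamseyNumber 4 r₁ r₂ →
    (a : Fin n) (S : ℕ → Subset n) → S 1 ≡ ⁅ a ⁆ →
    (∀ i → 1 ≤ i → i ≤ t ∸ 2 → Step G (S i) (S (suc i))) →
    ∀ i → 1 ≤ i → i ≤ t ∸ 2 → ∣ S (suc i) ∣ ≤ ∣ S i ∣ * (1 + r₂)
lemma3p1 s t _ _ G _ _ no-sdk no-K₄ r₁ r₂ (ramsey₁ , _) (ramsey₂ , _) a S _ steps i 1≤i i≤t-2 =
  SmallCovers.step-bound G no-sdk no-K₄ ramsey₁ ramsey₂ (steps i 1≤i i≤t-2)
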